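{- Let $k\geq 2$ and $n\geq 2k+1$ be integers. Then every $G\in\mathcal{G}_{k,n}$ is a connected graph of order $n$ satisfying $\sigma_{2}(G)=n-2$.
   Context: All graphs are finite and simple. For a graph $G$ and $u\in V(G)$, $d_G(u)$ is the degree of $u$. If $G$ is not complete, $\sigma_{2}(G)=\min\{d_{G}(u)+d_{G}(v): u,v\in V(G),\ u\neq v,\ uv\notin E(G)\}$; if $G$ is complete, $\sigma_2(G)=\infty$. For integers $k\geq 2$ and $n\geq 2k+1$, $\mathcal{G}_{k,n}$ is the family of graphs $G$ of order $n$ such that: (L1) $V(G)$ is the disjoint union of four non-empty sets $L_1,L_2,L_3,L_4$; (L2) $L_1\cup L_2$ and $L_4$ are cliques of $G$; (L3) every $u_1\in L_1$ has no neighbor in $L_3\cup L_4$; (L4) every $u_2\in L_2$ has a neighbor in $L_3$, no neighbor in $L_4$, and $d_G(u_2)\leq k$; (L5) every $u_3\in L_3$ has a neighbor in $L_2$, is adjacent to all vertices of $L_4$, and satisfies $d_G(u_3)\geq n-|L_1\cup L_2|-1$. -}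

module Defs where

open import Data.Nat using (ℕ; suc; _+_; _≤_)
open import Data.Bool using (Bool; true; false; if_then_else_)
open import Data.Fin using (Fin)
open import Data.List using (List; []; _∷_; length; filter)
open import Data.Fin.Base using (Fin)
open import Data.List.Base using (allFin)
open import Data.Product using (Σ; _×_; ∃; ∃-syntax; _,_)
open import Relation.Binary.PropositionalEquality using (_≡_; _≢_)
open import Relation.Nullary using (¬_)
open import Relation.Nullary.Decidable using (does)
open import Data.Bool using (T)
open import Data.Sum using (_⊎_)

record Graph (n : ℕ) : Set where
  field
    adj   : Fin n → Fin n → Bool
    sym   : ∀ u v → adj u v ≡ adj v u
    irrefl : ∀ u → adj u u ≡ false
open Graph public

E : ∀ {n} → Graph n → Fin n → Fin n → Set
E G u v = T (adj G u v)

deg : ∀ {n} → Graph n → Fin n → ℕ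
deg {n} G u = length (filter (λ v → Data.Bool._≟_ (adj G u v) true) (allFin n))

data Walk {n} (G : Graph n) : Fin n → Fin n → Set where
  here : ∀ {u} → Walk G u u
  step : ∀ {u v w} → E G u v → Walk G v w → Walk G u w

Connected : ∀ {n} → Graph n → Set
Connected {n} G = ∀ (u v : Fin n) → Walk G u v

Complete : ∀ {n} → Graph n → Set
Complete {n} G = ∀ (u v : Fin n) → u ≢ v → E G u v

-- σ₂(G) = m, for non-complete G: m is the minimum of d(u)+d(v) over
-- distinct non-adjacent pairs (attained, and a lower bound).
-- For complete G, σ₂(G) = ∞, so "σ₂(G) = m" with m ∈ ℕ is false.
Sigma2≡ : ∀ {n} → Graph n → ℕ → Set
Sigma2≡ {n} G m =
  (Σ (Fin n) λ u → Σ (Fin n) λ v → u ≢ v × ¬ E G u v × deg G u + deg G v ≡ m)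
  × (∀ (u v : Fin n) → u ≢ v → ¬ E G u v → m ≤ deg G u + deg G v)

data Part : Set where
  P1 P2 P3 P4 : Part

InFamily : (k n : ℕ) → Graph n → Set
InFamily k n G = Σ (Fin n → Part) λ L →
    (∃[ u ] L u ≡ P1) × (∃[ u ] L u ≡ P2) × (∃[ u ] L u ≡ P3) × (∃[ u ] L u ≡ P4)
  × (∀ u v → u ≢ v → (L u ≡ P1 ⊎ L u ≡ P2) → (L v ≡ P1 ⊎ L v ≡ P2) → E G u v)
  × (∀ u v → u ≢ v → L u ≡ P4 → L v ≡ P4 → E G u v)
  × (∀ u v → L u ≡ P1 → (L v ≡ P3 ⊎ L v ≡ P4) → ¬ E G u v)
  × (∀ u → L u ≡ P2 →
        (∃[ w ] (L w ≡ P3 × E G u w))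
      × (∀ v → L v ≡ P4 → ¬ E G u v)
      × deg G u ≤ k)
  -- (L5) vertices of L3: a neighbour in L2, adjacent to all of L4,
  --      d(u) ≥ n - |L1 ∪ L2| - 1, written as d(u) + |L1 ∪ L2| + 1 ≥ n
  × (∀ u → L u ≡ P3 →
        (∃[ w ] (L w ≡ P2 × E G u w))
      × (∀ v → L v ≡ P4 → E G u v)
      × n ≤ deg G u + size12 L + 1)
  where
    isP12 : Part → Bool
    isP12 P1 = true
    isP12 P2 = true
    isP12 _  = false
    size12 : (Fin n → Part) → ℕ
    size12 L = length (filter (λ v → Data.Bool._≟_ (isP12 (L v)) true) (allFin n))

-- Every vertex reaches a fixed vertex of L₄, since L₃ is joined to all of L₄, every vertex of
-- L₂ has a neighbour in L₃, and L₁ ∪ L₂ is a clique. For σ₂, let s = |L₁ ∪ L₂|. Closed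
-- neighbourhoods give d(u) + 1 = s on L₁, d(u) + 1 ≥ s on L₂ and d(u) + 1 = n − s on L₄, while
-- d(u) + 1 ≥ n − s on L₃ by hypothesis; a vertex of L₂ also sees a vertex of L₃, so s ≤ d(u) ≤ k.
-- Non-adjacent pairs either straddle L₁ ∪ L₂ and L₃ ∪ L₄, where the degree sum is at least
-- s + (n − s) − 2, or lie in L₃, where it is at least 2(n − k − 1) ≥ n − 1 as n ≥ 2k + 1.
-- A vertex of L₁ and one of L₄ attain n − 2.
module Submission where

open import Defs hiding (sym)
open import Data.Bool using (Bool; true; false; T; not; _∨_; if_then_else_) renaming (_≟_ to _≟ᵇ_)
open import Data.Bool.Properties using (T-∨; ∨-identityʳ; ∨-zeroʳ)
open import Data.Empty using (⊥-elim)
open import Data.Fin using (Fin; zero; suc; _≟_)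
open import Data.List using (length; filter; tabulate; allFin)
open import Data.Nat using (ℕ; zero; suc; _+_; _*_; _∸_; _≤_; z≤n; s≤s; s≤s⁻¹)
open import Data.Nat.Properties
  using (+-comm; +-suc; +-monoˡ-≤; +-monoʳ-≤; +-mono-≤; *-monoʳ-≤; +-cancelʳ-≤; ≤-antisym;
         ≤-trans; ≤-reflexive; m≤n⇒m≤1+n; m≤n+o⇒m∸n≤o; module ≤-Reasoning)
open import Data.Nat.Tactic.RingSolver using (solve-∀)
open import Data.Product using (Σ; _×_; _,_; ∃-syntax; proj₁; proj₂)
open import Data.Sum using (_⊎_; inj₁; inj₂)
open import Function using (_∘_; id; Equivalence)
open import Relation.Binary.PropositionalEquality
open import Relation.Nullary using (¬_; does; yes; no)
open import Relation.Nullary.Decidable using (T?)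

open Equivalence using (to; from)

private
  variable
    n : ℕ

count : (Fin n → Bool) → ℕ
count {zero}  p = 0
count {suc n} p = if p zero then suc (count (p ∘ suc)) else count (p ∘ suc)

_∪_ : (Fin n → Bool) → (Fin n → Bool) → Fin n → Bool
(p ∪ q) x = p x ∨ q x

⁅_⁆ : Fin n → Fin n → Bool
⁅ x ⁆ y = does (y ≟ x)

⁅⁆-sound : (x y : Fin n) → T (⁅ x ⁆ y) → y ≡ x
⁅⁆-sound x y y∈ with y ≟ x
... | yes y≡x = y≡x
... | no _    = ⊥-elim y∈

length-filter-tabulate : ∀ {A : Set} (p : A → Bool) (f : Fin n → A) →
  length (filter (λ a → p a ≟ᵇ true) (tabulate f)) ≡ count (p ∘ f)
length-filter-tabulate {zero}  p f = refl
length-filter-tabulate {suc n} p f with p (f zero)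
... | true  = cong suc (length-filter-tabulate p (f ∘ suc))
... | false = length-filter-tabulate p (f ∘ suc)

count-cong : {p q : Fin n → Bool} → (∀ x → p x ≡ q x) → count p ≡ count q
count-cong {zero}          _   = refl
count-cong {suc n} {p} {q} p≗q rewrite p≗q zero =
  cong (λ c → if q zero then suc c else c) (count-cong (p≗q ∘ suc))

count-mono : {p q : Fin n → Bool} → (∀ x → T (p x) → T (q x)) → count p ≤ count q
count-mono {zero}          _   = z≤n
count-mono {suc n} {p} {q} p⊆q with p zero | q zero | p⊆q zero
... | true  | true  | _ = s≤s (count-mono (p⊆q ∘ suc))
... | true  | false | h = ⊥-elim (h _)
... | false | true  | _ = m≤n⇒m≤1+n (count-mono (p⊆q ∘ suc))
... | false | false | _ = count-mono (p⊆q ∘ suc)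

count-insert : {p : Fin n → Bool} {x : Fin n} → ¬ T (p x) → count (p ∪ ⁅ x ⁆) ≡ suc (count p)
count-insert {suc n} {p} {zero} x∉p with p zero
... | true  = ⊥-elim (x∉p _)
... | false = cong suc (count-cong (λ y → ∨-identityʳ (p (suc y))))
count-insert {suc n} {p} {suc x} x∉p with p zero
... | true  = cong suc (count-insert {p = p ∘ suc} x∉p)
... | false = count-insert {p = p ∘ suc} x∉p

count+count-not : (p : Fin n → Bool) → count p + count (not ∘ p) ≡ n
count+count-not {zero}  p = refl
count+count-not {suc n} p with p zero
... | true  = cong suc (count+count-not (p ∘ suc))
... | false = trans (+-suc _ _) (cong suc (count+count-not (p ∘ suc)))

E-sym : (G : Graph n) {u v : Fin n} → E G u v → E G v u
E-sym G {u} {v} = subst T (Graph.sym G u v)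

_◅◅_ : {G : Graph n} {u v w : Fin n} → Walk G u v → Walk G v w → Walk G u w
here     ◅◅ q = q
step e p ◅◅ q = step e (p ◅◅ q)

reverse : {G : Graph n} {u v : Fin n} → Walk G u v → Walk G v u
reverse         here       = here
reverse {G = G} (step e p) = reverse p ◅◅ step (E-sym G e) here

connected-via : {G : Graph n} (h : Fin n) → (∀ u → Walk G u h) → Connected G
connected-via h reach u v = reach u ◅◅ reverse (reach v)

closedNbhd : Graph n → Fin n → Fin n → Bool
closedNbhd G u = adj G u ∪ ⁅ u ⁆

count-closedNbhd : (G : Graph n) (u : Fin n) → count (closedNbhd G u) ≡ suc (deg G u)
count-closedNbhd G u = begin
  count (closedNbhd G u) ≡⟨ count-insert {p = adj G u} (subst T (irrefl G u)) ⟩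
  suc (count (adj G u))  ≡⟨ cong suc (length-filter-tabulate (adj G u) id) ⟨
  suc (deg G u)          ∎
  where open ≡-Reasoning

closedNbhd-intro : (G : Graph n) {u v : Fin n} → (v ≢ u → E G u v) → T (closedNbhd G u v)
closedNbhd-intro G {u} {v} uv with v ≟ u
... | yes _   = subst T (sym (∨-zeroʳ (adj G u v))) _
... | no v≢u = T-∨ .from (inj₁ (uv v≢u))

closedNbhd-edge : (G : Graph n) {u v : Fin n} → E G u v → T (closedNbhd G u v)
closedNbhd-edge G uv = closedNbhd-intro G (λ _ → uv)

closedNbhd-elim : (G : Graph n) {u v : Fin n} → T (closedNbhd G u v) → E G u v ⊎ v ≡ u
closedNbhd-elim G {u} {v} v∈ with T-∨ .to v∈
... | inj₁ uv     = inj₁ uv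
... | inj₂ v∈⁅u⁆ = inj₂ (⁅⁆-sound u v v∈⁅u⁆)

cross-bound : ∀ {n s a b} → s ≤ suc a → n ≤ b + s + 1 → n ≤ 2 + (a + b)
cross-bound {n} {s} {a} {b} s≤1+a n≤b+s+1 = begin
  n             ≤⟨ n≤b+s+1 ⟩
  b + s + 1     ≤⟨ +-monoˡ-≤ 1 (+-monoʳ-≤ b s≤1+a) ⟩
  b + suc a + 1 ≡⟨ rearrange a b ⟩
  2 + (a + b)   ∎
  where
  open ≤-Reasoning
  rearrange : ∀ a b → b + suc a + 1 ≡ 2 + (a + b)
  rearrange = solve-∀

pair-bound : ∀ {n s k a b} → 2 * k + 1 ≤ n → s ≤ k → n ≤ a + s + 1 → n ≤ b + s + 1 →
  n ≤ 2 + (a + b)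
pair-bound {n} {s} {k} {a} {b} 2k+1≤n s≤k n≤a+s+1 n≤b+s+1 =
  m≤n⇒m≤1+n (+-cancelʳ-≤ (2 * k + 1) n (1 + (a + b)) (begin
    n + (2 * k + 1)           ≤⟨ +-monoʳ-≤ n 2k+1≤n ⟩
    n + n                     ≤⟨ +-mono-≤ n≤a+s+1 n≤b+s+1 ⟩
    a + s + 1 + (b + s + 1)   ≡⟨ rearrange a b s ⟩
    1 + (a + b) + (2 * s + 1) ≤⟨ +-monoʳ-≤ (1 + (a + b)) (+-monoˡ-≤ 1 (*-monoʳ-≤ 2 s≤k)) ⟩
    1 + (a + b) + (2 * k + 1) ∎))
  where
  open ≤-Reasoning
  rearrange : ∀ a b s → a + s + 1 + (b + s + 1) ≡ 1 + (a + b) + (2 * s + 1)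
  rearrange = solve-∀

inL₁₂ : Part → Bool
inL₁₂ P1 = true
inL₁₂ P2 = true
inL₁₂ P3 = false
inL₁₂ P4 = false

inL₁₂-complete : {p : Part} → p ≡ P1 ⊎ p ≡ P2 → T (inL₁₂ p)
inL₁₂-complete (inj₁ refl) = _
inL₁₂-complete (inj₂ refl) = _

inL₁₂-sound : (p : Part) → T (inL₁₂ p) → p ≡ P1 ⊎ p ≡ P2
inL₁₂-sound P1 _ = inj₁ refl
inL₁₂-sound P2 _ = inj₂ refl

distinct-layers : {L : Fin n → Part} {u v : Fin n} {p q : Part} →
  L u ≡ p → L v ≡ q → p ≢ q → u ≢ v
distinct-layers Lu≡p Lv≡q p≢q refl = p≢q (trans (sym Lu≡p) Lv≡q)

module Layered {k n : ℕ} (G : Graph n) (L : Fin n → Part)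
  (s : ℕ) (count-L₁₂ : count (inL₁₂ ∘ L) ≡ s)
  (a₁ a₂ a₄ : Fin n) (a₁∈L₁ : L a₁ ≡ P1) (a₂∈L₂ : L a₂ ≡ P2) (a₄∈L₄ : L a₄ ≡ P4)
  (clique₁₂ : ∀ u v → u ≢ v → (L u ≡ P1 ⊎ L u ≡ P2) → (L v ≡ P1 ⊎ L v ≡ P2) → E G u v)
  (clique₄ : ∀ u v → u ≢ v → L u ≡ P4 → L v ≡ P4 → E G u v)
  (L₁-isolated : ∀ u v → L u ≡ P1 → (L v ≡ P3 ⊎ L v ≡ P4) → ¬ E G u v)
  (L₂-spec : ∀ u → L u ≡ P2 →
        (∃[ w ] (L w ≡ P3 × E G u w))
      × (∀ v → L v ≡ P4 → ¬ E G u v)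
      × deg G u ≤ k)
  (L₃-spec : ∀ u → L u ≡ P3 →
        (∃[ w ] (L w ≡ P2 × E G u w))
      × (∀ v → L v ≡ P4 → E G u v)
      × n ≤ deg G u + s + 1)
  where

  L₃-reaches : ∀ u → L u ≡ P3 → Walk G u a₄
  L₃-reaches u u∈L₃ = step (proj₁ (proj₂ (L₃-spec u u∈L₃)) a₄ a₄∈L₄) here

  L₂-reaches : ∀ u → L u ≡ P2 → Walk G u a₄
  L₂-reaches u u∈L₂ with proj₁ (L₂-spec u u∈L₂)
  ... | w , w∈L₃ , uw = step uw (L₃-reaches w w∈L₃)

  L₁-reaches : ∀ u → L u ≡ P1 → Walk G u a₄
  L₁-reaches u u∈L₁ =
    step (clique₁₂ u a₂ (distinct-layers u∈L₁ a₂∈L₂ λ ()) (inj₁ u∈L₁) (inj₂ a₂∈L₂))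
         (L₂-reaches a₂ a₂∈L₂)

  L₄-reaches : ∀ u → L u ≡ P4 → Walk G u a₄
  L₄-reaches u u∈L₄ with u ≟ a₄
  ... | yes refl = here
  ... | no u≢a₄ = step (clique₄ u a₄ u≢a₄ u∈L₄ a₄∈L₄) here

  connected : Connected G
  connected = connected-via a₄ reaches
    where
    reaches : ∀ u → Walk G u a₄
    reaches u with L u in u∈
    ... | P1 = L₁-reaches u u∈
    ... | P2 = L₂-reaches u u∈
    ... | P3 = L₃-reaches u u∈
    ... | P4 = L₄-reaches u u∈

  L₁₂⊆closedNbhd : ∀ {u} → T (inL₁₂ (L u)) → ∀ v → T (inL₁₂ (L v)) → T (closedNbhd G u v)
  L₁₂⊆closedNbhd {u} u∈ v v∈ = closedNbhd-intro G λ v≢u →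
    clique₁₂ u v (v≢u ∘ sym) (inL₁₂-sound (L u) u∈) (inL₁₂-sound (L v) v∈)

  closedNbhd-L₁⊆L₁₂ : ∀ {u} → L u ≡ P1 → ∀ v → T (closedNbhd G u v) → T (inL₁₂ (L v))
  closedNbhd-L₁⊆L₁₂ {u} u∈L₁ v v∈ with closedNbhd-elim G v∈
  ... | inj₂ refl = inL₁₂-complete (inj₁ u∈L₁)
  ... | inj₁ uv with L v in v∈Lᵢ
  ...   | P1 = _
  ...   | P2 = _
  ...   | P3 = L₁-isolated u v u∈L₁ (inj₁ v∈Lᵢ) uv
  ...   | P4 = L₁-isolated u v u∈L₁ (inj₂ v∈Lᵢ) uv

  L₃₄⊆closedNbhd-L₄ : ∀ {u} → L u ≡ P4 → ∀ v → T (not (inL₁₂ (L v))) → T (closedNbhd G u v)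
  L₃₄⊆closedNbhd-L₄ {u} u∈L₄ v v∉ with L v in v∈Lᵢ
  ... | P3 = closedNbhd-edge G (E-sym G (proj₁ (proj₂ (L₃-spec v v∈Lᵢ)) u u∈L₄))
  ... | P4 = closedNbhd-intro G λ v≢u → clique₄ u v (v≢u ∘ sym) u∈L₄ v∈Lᵢ

  closedNbhd-L₄⊆L₃₄ : ∀ {u} → L u ≡ P4 → ∀ v → T (closedNbhd G u v) → T (not (inL₁₂ (L v)))
  closedNbhd-L₄⊆L₃₄ {u} u∈L₄ v v∈ with closedNbhd-elim G v∈
  ... | inj₂ refl = subst (T ∘ not ∘ inL₁₂) (sym u∈L₄) _
  ... | inj₁ uv with L v in v∈Lᵢ
  ...   | P1 = L₁-isolated v u v∈Lᵢ (inj₂ u∈L₄) (E-sym G uv)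
  ...   | P2 = proj₁ (proj₂ (L₂-spec v v∈Lᵢ)) u u∈L₄ (E-sym G uv)
  ...   | P3 = _
  ...   | P4 = _

  L₁₂-bound : ∀ u → T (inL₁₂ (L u)) → s ≤ suc (deg G u)
  L₁₂-bound u u∈ = begin
    s                      ≡⟨ count-L₁₂ ⟨
    count (inL₁₂ ∘ L)      ≤⟨ count-mono (L₁₂⊆closedNbhd u∈) ⟩
    count (closedNbhd G u) ≡⟨ count-closedNbhd G u ⟩
    suc (deg G u)          ∎
    where open ≤-Reasoning

  deg-L₁ : ∀ u → L u ≡ P1 → suc (deg G u) ≡ s
  deg-L₁ u u∈L₁ = ≤-antisym
    (begin
      suc (deg G u)          ≡⟨ count-closedNbhd G u ⟨
      count (closedNbhd G u) ≤⟨ count-mono (closedNbhd-L₁⊆L₁₂ u∈L₁) ⟩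
      count (inL₁₂ ∘ L)      ≡⟨ count-L₁₂ ⟩
      s                      ∎)
    (L₁₂-bound u (inL₁₂-complete (inj₁ u∈L₁)))
    where open ≤-Reasoning

  deg-L₄ : ∀ u → L u ≡ P4 → s + suc (deg G u) ≡ n
  deg-L₄ u u∈L₄ = begin
    s + suc (deg G u)                           ≡⟨ cong₂ _+_ count-L₁₂ closed-L₄ ⟨
    count (inL₁₂ ∘ L) + count (not ∘ inL₁₂ ∘ L) ≡⟨ count+count-not (inL₁₂ ∘ L) ⟩
    n                                           ∎
    where
    open ≡-Reasoning
    closed-L₄ : count (not ∘ inL₁₂ ∘ L) ≡ suc (deg G u)
    closed-L₄ = trans
      (≤-antisym (count-mono (L₃₄⊆closedNbhd-L₄ u∈L₄)) (count-mono (closedNbhd-L₄⊆L₃₄ u∈L₄)))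
      (count-closedNbhd G u)

  L₂-bound : ∀ u → L u ≡ P2 → s ≤ deg G u
  L₂-bound u u∈L₂ with proj₁ (L₂-spec u u∈L₂)
  ... | w , w∈L₃ , uw = s≤s⁻¹ (begin
    suc s                       ≡⟨ cong suc count-L₁₂ ⟨
    suc (count (inL₁₂ ∘ L))     ≡⟨ count-insert {p = inL₁₂ ∘ L} (subst (T ∘ inL₁₂) w∈L₃) ⟨
    count ((inL₁₂ ∘ L) ∪ ⁅ w ⁆) ≤⟨ count-mono L₁₂+w⊆closedNbhd ⟩
    count (closedNbhd G u)      ≡⟨ count-closedNbhd G u ⟩
    suc (deg G u)               ∎)
    where
    open ≤-Reasoning
    L₁₂+w⊆closedNbhd : ∀ v → T (inL₁₂ (L v) ∨ ⁅ w ⁆ v) → T (closedNbhd G u v)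
    L₁₂+w⊆closedNbhd v v∈ with T-∨ .to v∈
    ... | inj₁ v∈L₁₂ = L₁₂⊆closedNbhd (inL₁₂-complete (inj₂ u∈L₂)) v v∈L₁₂
    ... | inj₂ v∈⁅w⁆ with ⁅⁆-sound w v v∈⁅w⁆
    ...   | refl = closedNbhd-edge G uw

  s≤k : s ≤ k
  s≤k = ≤-trans (L₂-bound a₂ a₂∈L₂) (proj₂ (proj₂ (L₂-spec a₂ a₂∈L₂)))

  L₃₄-bound : ∀ u → ¬ T (inL₁₂ (L u)) → n ≤ deg G u + s + 1
  L₃₄-bound u u∉ with L u in u∈Lᵢ
  ... | P1 = ⊥-elim (u∉ _)
  ... | P2 = ⊥-elim (u∉ _)
  ... | P3 = proj₂ (proj₂ (L₃-spec u u∈Lᵢ))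
  ... | P4 = ≤-reflexive (trans (sym (deg-L₄ u u∈Lᵢ)) (rearrange s (deg G u)))
    where
    rearrange : ∀ s d → s + suc d ≡ d + s + 1
    rearrange = solve-∀

  nonadjacent-L₃₄ : ∀ u v → u ≢ v → ¬ E G u v → ¬ T (inL₁₂ (L u)) → ¬ T (inL₁₂ (L v)) →
    L u ≡ P3 × L v ≡ P3
  nonadjacent-L₃₄ u v u≢v u≁v u∉ v∉ with L u in u∈Lᵢ | L v in v∈Lᵢ
  ... | P1 | _  = ⊥-elim (u∉ _)
  ... | P2 | _  = ⊥-elim (u∉ _)
  ... | _  | P1 = ⊥-elim (v∉ _)
  ... | _  | P2 = ⊥-elim (v∉ _)
  ... | P3 | P3 = refl , refl
  ... | P3 | P4 = ⊥-elim (u≁v (proj₁ (proj₂ (L₃-spec u u∈Lᵢ)) v v∈Lᵢ))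
  ... | P4 | P3 = ⊥-elim (u≁v (E-sym G (proj₁ (proj₂ (L₃-spec v v∈Lᵢ)) u u∈Lᵢ)))
  ... | P4 | P4 = ⊥-elim (u≁v (clique₄ u v u≢v u∈Lᵢ v∈Lᵢ))

  nonadjacent-bound : 2 * k + 1 ≤ n → ∀ u v → u ≢ v → ¬ E G u v →
    n ≤ 2 + (deg G u + deg G v)
  nonadjacent-bound 2k+1≤n u v u≢v u≁v with T? (inL₁₂ (L u)) | T? (inL₁₂ (L v))
  ... | yes u∈ | yes v∈ =
    ⊥-elim (u≁v (clique₁₂ u v u≢v (inL₁₂-sound (L u) u∈) (inL₁₂-sound (L v) v∈)))
  ... | yes u∈ | no v∉ = cross-bound (L₁₂-bound u u∈) (L₃₄-bound v v∉)
  ... | no u∉ | yes v∈ =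
    subst (n ≤_) (cong (2 +_) (+-comm (deg G v) (deg G u)))
      (cross-bound (L₁₂-bound v v∈) (L₃₄-bound u u∉))
  ... | no u∉ | no v∉ with nonadjacent-L₃₄ u v u≢v u≁v u∉ v∉
  ...   | u∈L₃ , v∈L₃ =
    pair-bound 2k+1≤n s≤k (proj₂ (proj₂ (L₃-spec u u∈L₃))) (proj₂ (proj₂ (L₃-spec v v∈L₃)))

  σ₂≡n∸2 : 2 * k + 1 ≤ n → Sigma2≡ G (n ∸ 2)
  σ₂≡n∸2 2k+1≤n =
    ( a₁ , a₄ , distinct-layers a₁∈L₁ a₄∈L₄ (λ ()) , L₁-isolated a₁ a₄ a₁∈L₁ (inj₂ a₄∈L₄)
    , deg-a₁+deg-a₄ )
    , λ u v u≢v u≁v → m≤n+o⇒m∸n≤o n 2 (nonadjacent-bound 2k+1≤n u v u≢v u≁v)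
    where
    deg-a₁+deg-a₄ : deg G a₁ + deg G a₄ ≡ n ∸ 2
    deg-a₁+deg-a₄ = sym (begin
      n ∸ 2                               ≡⟨ cong (_∸ 2) (deg-L₄ a₄ a₄∈L₄) ⟨
      s + suc (deg G a₄) ∸ 2              ≡⟨ cong (λ x → x + suc (deg G a₄) ∸ 2) (deg-L₁ a₁ a₁∈L₁) ⟨
      suc (deg G a₁) + suc (deg G a₄) ∸ 2 ≡⟨ cong (_∸ 1) (+-suc (deg G a₁) (deg G a₄)) ⟩
      deg G a₁ + deg G a₄                 ∎)
      where open ≡-Reasoning

-- InFamily measures |L₁ ∪ L₂| through a classifier local to its where-block, which cannot be
-- named here. InFamilyWith abstracts that size as S, so InFamily k n G unifies with it; the
-- first hypothesis of count-classified, unused by its proof, lets unification recover the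
-- classifier as f from the constant layerings λ _ → p.
InFamilyWith : (k n : ℕ) → Graph n → ((Fin n → Part) → ℕ) → Set
InFamilyWith k n G S = Σ (Fin n → Part) λ L →
    (∃[ u ] L u ≡ P1) × (∃[ u ] L u ≡ P2) × (∃[ u ] L u ≡ P3) × (∃[ u ] L u ≡ P4)
  × (∀ u v → u ≢ v → (L u ≡ P1 ⊎ L u ≡ P2) → (L v ≡ P1 ⊎ L v ≡ P2) → E G u v)
  × (∀ u v → u ≢ v → L u ≡ P4 → L v ≡ P4 → E G u v)
  × (∀ u v → L u ≡ P1 → (L v ≡ P3 ⊎ L v ≡ P4) → ¬ E G u v)
  × (∀ u → L u ≡ P2 →
        (∃[ w ] (L w ≡ P3 × E G u w))
      × (∀ v → L v ≡ P4 → ¬ E G u v)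
      × deg G u ≤ k)
  × (∀ u → L u ≡ P3 →
        (∃[ w ] (L w ≡ P2 × E G u w))
      × (∀ v → L v ≡ P4 → E G u v)
      × n ≤ deg G u + S L + 1)

count-classified : (S : (Fin n → Part) → ℕ) (f : Part → Bool) →
  (∀ p → S (λ _ → p) ≡ length (filter (λ _ → f p ≟ᵇ true) (allFin n))) →
  (∀ L → S L ≡ length (filter (λ v → f (L v) ≟ᵇ true) (allFin n))) →
  (∀ p → f p ≡ inL₁₂ p) → ∀ L → S L ≡ count (inL₁₂ ∘ L)
count-classified S f _ S≡ f≗inL₁₂ L =
  trans (S≡ L) (trans (length-filter-tabulate (f ∘ L) id) (count-cong (f≗inL₁₂ ∘ L)))

family-connected×σ₂ : ∀ {k n} {G : Graph n} {S : (Fin n → Part) → ℕ} →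
  2 * k + 1 ≤ n → InFamilyWith k n G S → (∀ L → S L ≡ count (inL₁₂ ∘ L)) →
  Connected G × Sigma2≡ G (n ∸ 2)
family-connected×σ₂ {G = G} {S} 2k+1≤n
  (L , (a₁ , a₁∈L₁) , (a₂ , a₂∈L₂) , _ , (a₄ , a₄∈L₄) ,
   clique₁₂ , clique₄ , L₁-isolated , L₂-spec , L₃-spec)
  S≡count = connected , σ₂≡n∸2 2k+1≤n
  where
  open Layered G L (S L) (sym (S≡count L)) a₁ a₂ a₄ a₁∈L₁ a₂∈L₂ a₄∈L₄
    clique₁₂ clique₄ L₁-isolated L₂-spec L₃-spec

proposition3p1 : (k n : ℕ) → 2 ≤ k → 2 * k + 1 ≤ n → (G : Graph n) →
    InFamily k n G → Connected G × Sigma2≡ G (n ∸ 2)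
proposition3p1 k n _ 2k+1≤n G fam = family-connected×σ₂ 2k+1≤n fam
  (count-classified _ _ (λ _ → refl) (λ _ → refl)
    λ { P1 → refl ; P2 → refl ; P3 → refl ; P4 → refl })
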